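{- Let $G$ be a finite abstract simplicial complex of dimension $d$ which is Dehn-Sommerville. Then $\chi(G)=1+(-1)^d$.
   Context: A finite abstract simplicial complex $G$ is a finite set of nonempty finite sets closed under taking nonempty subsets. $f_k(G)$ is the number of sets in $G$ with $k+1$ elements, the dimension $d$ is the largest $k$ with $f_k(G)\neq0$, $f_G(t)=1+\sum_{k=0}^d f_k(G)t^{k+1}$, and $\chi(G)=\sum_{k=0}^d(-1)^k f_k(G)$. The $h$-vector $(h_0,\dots,h_{d+1})$ is defined by $h_G(x)=(x-1)^{d+1}f_G(1/(x-1))=\sum_{i=0}^{d+1}h_ix^i$; $G$ is Dehn-Sommerville if $h_i=h_{d+1-i}$ for all $i$. -}

module Defs where

open import Data.Nat using (ℕ; zero; suc; _∸_; _≟_)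
open import Data.Nat.Combinatorics using (_C_)
open import Data.Integer using (ℤ; +_; -_; _+_; _*_)
open import Data.List using (List; length; filter; map; upTo; foldr)
open import Data.List.Membership.Propositional using (_∈_)
open import Data.List.Relation.Unary.All using (All)
open import Data.List.Relation.Unary.Unique.Propositional using (Unique)
open import Data.Fin.Subset using (Subset; _⊆_; Nonempty; ∣_∣)
open import Data.Product using (_×_)
open import Relation.Binary.PropositionalEquality using (_≡_; _≢_)

record IsSimplicialComplex {n : ℕ} (G : List (Subset n)) : Set where
  field
    unique   : Unique G
    nonempty : All Nonempty G
    closed   : ∀ {s t : Subset n} → s ∈ G → t ⊆ s → Nonempty t → t ∈ G

Σ< : ℕ → (ℕ → ℤ) → ℤ
Σ< m f = foldr _+_ (+ 0) (map f (upTo m))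

sgn : ℕ → ℤ
sgn zero = + 1
sgn (suc k) = - sgn k

card : ∀ {n} → List (Subset n) → ℕ → ℕ
card G j = length (filter (λ s → ∣ s ∣ ≟ j) G)

f : ∀ {n} → List (Subset n) → ℕ → ℕ
f G k = card G (suc k)

-- coefficients of 1 + Σ_k f_k t^{k+1}: F 0 = 1, F (k+1) = f_k
F : ∀ {n} → List (Subset n) → ℕ → ℕ
F G zero = 1
F G (suc k) = f G k

IsDim : ∀ {n} → List (Subset n) → ℕ → Set
IsDim G d = (f G d ≢ 0) × (∀ k → d Data.Nat.< k → f G k ≡ 0)

χ : ∀ {n} → List (Subset n) → ℕ → ℤ
χ G d = Σ< (suc d) (λ k → sgn k * + f G k)

-- h-vector: h_G(x) = (x-1)^{d+1} f_G(1/(x-1)) = Σ_{j=0}^{d+1} F_j (x-1)^{d+1-j};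
-- expanding (x-1)^m = Σ_i C(m,i) (-1)^{m-i} x^i gives the coefficient
-- h_i = Σ_{j=0}^{d+1} F_j · C(d+1-j, i) · (-1)^{d+1-j-i}
-- (terms with i > d+1-j vanish since the binomial coefficient is 0).
h : ∀ {n} → List (Subset n) → ℕ → ℕ → ℤ
h G d i = Σ< (suc (suc d)) (λ j →
  (+ F G j) * ((+ ((suc d ∸ j) C i)) * sgn (suc d ∸ j ∸ i)))

DehnSommerville : ∀ {n} → List (Subset n) → ℕ → Set
DehnSommerville G d = ∀ i → i Data.Nat.≤ suc d → h G d i ≡ h G d (suc d ∸ i)

module Submission where

-- Write F_0 = 1, F_{k+1} = f_k for the coefficients of f_G, so
-- that h_G(x) = Σ_j F_j (x-1)^{d+1-j}.  Two coefficients of h_G are explicit: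
--   * the leading one, h_{d+1}, only receives the j = 0 term, so h_{d+1} = F_0 = 1;
--   * the constant one is h_0 = h_G(0) = Σ_j F_j (-1)^{d+1-j}
--     = (-1)^{d+1} Σ_j (-1)^j F_j = (-1)^{d+1} (1 - χ(G)).
-- The Dehn–Sommerville relation for i = 0 says h_0 = h_{d+1}, hence
-- (-1)^{d+1} (1 - χ) = 1, and since (-1)^{d+1} is its own inverse,
-- 1 - χ = (-1)^{d+1} = -(-1)^d, i.e. χ = 1 + (-1)^d.

open import Defs
open import Data.Nat using (ℕ; zero; suc; _∸_; _≤_; _<_; s≤s; z≤n)
open import Data.Nat.Properties using (m∸n≤m; n∸n≡0; ≤-refl)
open import Data.Nat.Combinatorics using (_C_; nCn≡1; k>n⇒nCk≡0)
open import Data.List using (List; foldr)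
open import Data.List.Properties using (map-applyUpTo)
open import Data.Fin.Subset using (Subset)
open import Data.Integer using (ℤ; +_; -_; _+_; _-_; _*_)
open import Data.Integer.Properties
  using (*-identityˡ; *-identityʳ; *-zeroʳ; *-assoc; *-distribˡ-+; -1*i≡-i; neg-distribˡ-*)
open import Data.Integer.Solver using (module +-*-Solver)
open import Function using (_∘_)
open import Relation.Binary.PropositionalEquality
open ≡-Reasoning
open +-*-Solver

Σ<-suc : ∀ m (φ : ℕ → ℤ) → Σ< (suc m) φ ≡ φ 0 + Σ< m (φ ∘ suc)
Σ<-suc m φ = cong (λ xs → φ 0 + foldr _+_ (+ 0) xs)
  (trans (map-applyUpTo suc φ m) (sym (map-applyUpTo (λ k → k) (φ ∘ suc) m)))

Σ<-cong : ∀ m {φ ψ : ℕ → ℤ} → (∀ k → k < m → φ k ≡ ψ k) → Σ< m φ ≡ Σ< m ψ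
Σ<-cong zero    eq = refl
Σ<-cong (suc m) {φ} {ψ} eq = begin
  Σ< (suc m) φ           ≡⟨ Σ<-suc m φ ⟩
  φ 0 + Σ< m (φ ∘ suc)   ≡⟨ cong₂ _+_ (eq 0 (s≤s z≤n)) (Σ<-cong m (λ k k<m → eq (suc k) (s≤s k<m))) ⟩
  ψ 0 + Σ< m (ψ ∘ suc)   ≡⟨ Σ<-suc m ψ ⟨
  Σ< (suc m) ψ           ∎

Σ<-vanishing : ∀ m {φ : ℕ → ℤ} → (∀ k → k < m → φ k ≡ + 0) → Σ< m φ ≡ + 0
Σ<-vanishing zero    eq = refl
Σ<-vanishing (suc m) {φ} eq = begin
  Σ< (suc m) φ           ≡⟨ Σ<-suc m φ ⟩
  φ 0 + Σ< m (φ ∘ suc)   ≡⟨ cong₂ _+_ (eq 0 (s≤s z≤n)) (Σ<-vanishing m (λ k k<m → eq (suc k) (s≤s k<m))) ⟩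
  + 0                    ∎

Σ<-scale : ∀ m c (φ : ℕ → ℤ) → c * Σ< m φ ≡ Σ< m (λ k → c * φ k)
Σ<-scale zero    c φ = *-zeroʳ c
Σ<-scale (suc m) c φ = begin
  c * Σ< (suc m) φ                  ≡⟨ cong (c *_) (Σ<-suc m φ) ⟩
  c * (φ 0 + Σ< m (φ ∘ suc))        ≡⟨ *-distribˡ-+ c (φ 0) _ ⟩
  c * φ 0 + c * Σ< m (φ ∘ suc)      ≡⟨ cong (_+_ (c * φ 0)) (Σ<-scale m c (φ ∘ suc)) ⟩
  c * φ 0 + Σ< m (λ k → c * φ (suc k)) ≡⟨ Σ<-suc m (λ k → c * φ k) ⟨
  Σ< (suc m) (λ k → c * φ k)        ∎

Σ<-neg : ∀ m (φ : ℕ → ℤ) → - Σ< m φ ≡ Σ< m (λ k → - φ k)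
Σ<-neg m φ = begin
  - Σ< m φ                   ≡⟨ -1*i≡-i (Σ< m φ) ⟨
  - + 1 * Σ< m φ             ≡⟨ Σ<-scale m (- + 1) φ ⟩
  Σ< m (λ k → - + 1 * φ k)   ≡⟨ Σ<-cong m (λ k _ → -1*i≡-i (φ k)) ⟩
  Σ< m (λ k → - φ k)         ∎

sgn-∸ : ∀ {m j} → j ≤ m → sgn (m ∸ j) ≡ sgn m * sgn j
sgn-∸ {m} z≤n = sym (*-identityʳ (sgn m))
sgn-∸ {suc m} {suc j} (s≤s j≤m) = begin
  sgn (m ∸ j)                   ≡⟨ sgn-∸ j≤m ⟩
  sgn m * sgn j                 ≡⟨ solve 2 (λ a b → a :* b := (:- a) :* (:- b)) refl (sgn m) (sgn j) ⟩
  sgn (suc m) * sgn (suc j)     ∎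

sgn-square : ∀ m → sgn m * sgn m ≡ + 1
sgn-square m = trans (sym (sgn-∸ (≤-refl {m}))) (cong sgn (n∸n≡0 m))

involution-inverse : ∀ s y → s * s ≡ + 1 → s * y ≡ + 1 → y ≡ s
involution-inverse s y ss sy = begin
  y             ≡⟨ *-identityˡ y ⟨
  + 1 * y       ≡⟨ cong (_* y) ss ⟨
  s * s * y     ≡⟨ *-assoc s s y ⟩
  s * (s * y)   ≡⟨ cong (s *_) sy ⟩
  s * + 1       ≡⟨ *-identityʳ s ⟩
  s             ∎

module _ {n : ℕ} (G : List (Subset n)) (d : ℕ) where

  -- The leading coefficient h_{d+1} equals F_0 = 1: for j ≥ 1 the binomial
  -- coefficient C(d+1-j, d+1) vanishes.
  h-leading : h G d (suc d) ≡ + 1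
  h-leading = begin
    h G d (suc d)                      ≡⟨ Σ<-suc (suc d) term ⟩
    term 0 + Σ< (suc d) (term ∘ suc)   ≡⟨ cong₂ _+_ leading (Σ<-vanishing (suc d) higher) ⟩
    + 1                                ∎
    where
    term : ℕ → ℤ
    term j = + F G j * (+ ((suc d ∸ j) C suc d) * sgn (suc d ∸ j ∸ suc d))

    leading : term 0 ≡ + 1
    leading rewrite nCn≡1 (suc d) | n∸n≡0 d = refl

    higher : ∀ k → k < suc d → term (suc k) ≡ + 0
    higher k _ rewrite k>n⇒nCk≡0 {d ∸ k} {suc d} (s≤s (m∸n≤m d k)) = *-zeroʳ (+ f G k)

  -- The alternating sum of the F_j is 1 - χ(G): the shift F_{k+1} = f_k flips the sign.
  alternating-F : Σ< (suc (suc d)) (λ j → sgn j * + F G j) ≡ + 1 - χ G d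
  alternating-F = begin
    Σ< (suc (suc d)) (λ j → sgn j * + F G j)          ≡⟨ Σ<-suc (suc d) (λ j → sgn j * + F G j) ⟩
    + 1 + Σ< (suc d) (λ k → - sgn k * + f G k)       ≡⟨ cong (_+_ (+ 1)) (Σ<-cong (suc d) (λ k _ → sym (neg-distribˡ-* (sgn k) (+ f G k)))) ⟩
    + 1 + Σ< (suc d) (λ k → - (sgn k * + f G k))     ≡⟨ cong (_+_ (+ 1)) (Σ<-neg (suc d) (λ k → sgn k * + f G k)) ⟨
    + 1 - χ G d                                      ∎

  -- The constant coefficient is h_0 = h_G(0) = (-1)^{d+1} f_G(-1) = (-1)^{d+1} (1 - χ(G)).
  h-constant : h G d 0 ≡ sgn (suc d) * (+ 1 - χ G d)
  h-constant = begin
    h G d 0                                                    ≡⟨ Σ<-cong (suc (suc d)) factor-sign ⟩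
    Σ< (suc (suc d)) (λ j → sgn (suc d) * (sgn j * + F G j))   ≡⟨ Σ<-scale (suc (suc d)) (sgn (suc d)) _ ⟨
    sgn (suc d) * Σ< (suc (suc d)) (λ j → sgn j * + F G j)     ≡⟨ cong (sgn (suc d) *_) alternating-F ⟩
    sgn (suc d) * (+ 1 - χ G d)                                ∎
    where
    factor-sign : ∀ j → j < suc (suc d) →
      + F G j * (+ 1 * sgn (suc d ∸ j)) ≡ sgn (suc d) * (sgn j * + F G j)
    factor-sign j (s≤s j≤d+1) = begin
      + F G j * (+ 1 * sgn (suc d ∸ j))      ≡⟨ cong (+ F G j *_) (*-identityˡ _) ⟩
      + F G j * sgn (suc d ∸ j)              ≡⟨ cong (+ F G j *_) (sgn-∸ j≤d+1) ⟩
      + F G j * (sgn (suc d) * sgn j)        ≡⟨ solve 3 (λ x a b → x :* (a :* b) := a :* (b :* x)) refl (+ F G j) (sgn (suc d)) (sgn j) ⟩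
      sgn (suc d) * (sgn j * + F G j)        ∎

mainTheorem3 : (n : ℕ) (G : List (Subset n)) (d : ℕ) →
    IsSimplicialComplex G → IsDim G d → DehnSommerville G d →
    χ G d ≡ + 1 + sgn d
mainTheorem3 n G d _ _ ds = begin
  χ G d                      ≡⟨ solve 2 (λ x a → x := a :+ :- (a :+ :- x)) refl (χ G d) (+ 1) ⟩
  + 1 - (+ 1 - χ G d)        ≡⟨ cong (λ y → + 1 - y) one-minus-χ ⟩
  + 1 - sgn (suc d)          ≡⟨ solve 1 (λ s → con (+ 1) :+ :- (:- s) := con (+ 1) :+ s) refl (sgn d) ⟩
  + 1 + sgn d                ∎
  where
  h₀≡1 : sgn (suc d) * (+ 1 - χ G d) ≡ + 1
  h₀≡1 = trans (sym (h-constant G d)) (trans (ds 0 z≤n) (h-leading G d))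

  one-minus-χ : + 1 - χ G d ≡ sgn (suc d)
  one-minus-χ = involution-inverse (sgn (suc d)) _ (sgn-square (suc d)) h₀≡1
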